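{- Let $C$ be a Boolean automata circuit of size $n$. Then for all configurations $x,y\in\{0,1\}^n$, if $u(x)>u(y)$ then $x\stackrel{\ast}{\rightarrow} y$ and it is not the case that $y\stackrel{\ast}{\rightarrow} x$.
   Context: A Boolean automata circuit of size $n\ge1$ has node set $V=\{0,\dots,n-1\}$, identified with $\mathbb{Z}/n\mathbb{Z}$ (indices mod $n$), arcs $(i,i+1)$, and local transition functions $f_i\in\{id,neg\}$ ($id(a)=a$, $neg(a)=1-a$), node $i$ depending on node $i-1$. For $P\subseteq V$ define $F^P:\{0,1\}^n\to\{0,1\}^n$ by $F^P(x)_i=f_i(x_{i-1})$ if $i\in P$ and $F^P(x)_i=x_i$ otherwise. For $x\in\{0,1\}^n$, $U(x)=\{i\in V: x_i\neq f_i(x_{i-1})\}$ and $u(x)=|U(x)|$. Write $x\to y$ if there is $P\subseteq V$ with $y=F^P(x)$; $\stackrel{\ast}{\rightarrow}$ is the reflexive–transitive closure of $\to$. -}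

module Defs where

open import Data.Nat using (ℕ; zero; suc; _+_)
open import Data.Bool using (Bool; true; false; not; if_then_else_)
open import Data.Fin using (Fin; zero; suc; toℕ; fromℕ; inject₁)
open import Data.Product using (∃)
open import Data.Vec.Functional using (Vector; foldr)
open import Relation.Binary.PropositionalEquality using (_≡_)
open import Relation.Binary.Construct.Closure.ReflexiveTransitive using (Star)
open import Relation.Nullary.Decidable using (⌊_⌋)
open import Data.Bool.Properties using () renaming (_≟_ to _≟B_)

data LocalFun : Set where
  idf negf : LocalFun

apply : LocalFun → Bool → Bool
apply idf  a = a
apply negf a = not a

Circuit : ℕ → Set
Circuit n = Fin n → LocalFun

Config : ℕ → Set
Config n = Fin n → Bool

pred : ∀ {m} → Fin (suc m) → Fin (suc m)
pred {m} zero = fromℕ m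
pred (suc i) = inject₁ i

update : ∀ {m} → Circuit (suc m) → (Fin (suc m) → Bool) → Config (suc m) → Config (suc m)
update f P x i = if P i then apply (f i) (x (pred i)) else x i

Step : ∀ {m} → Circuit (suc m) → Config (suc m) → Config (suc m) → Set
Step f x y = ∃ λ (P : Fin _ → Bool) → ∀ i → y i ≡ update f P x i

Reach : ∀ {m} → Circuit (suc m) → Config (suc m) → Config (suc m) → Set
Reach f = Star (Step f)

count : ∀ {n} → Vector Bool n → ℕ
count = foldr (λ b k → if b then suc k else k) 0

unstable : ∀ {m} → Circuit (suc m) → Config (suc m) → Fin (suc m) → Bool
unstable f x i = not ⌊ x i ≟B apply (f i) (x (pred i)) ⌋

u : ∀ {m} → Circuit (suc m) → Config (suc m) → ℕ
u f x = count (unstable f x)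

-- Updating a set P leaves node i unstable only if it was unstable and not updated, or if
-- its predecessor was unstable and updated; summing around the cycle, u never increases
-- along a step, so y →* x is impossible when u(x) > u(y).
--
-- Conversely, the k-th parallel iterate of x satisfies xᵏ_i = x_i xor (parity of the number
-- of unstable nodes of x among i, i-1, …, i-k+1).  Heights t with t_i ≤ t_{i-1} + 1 around
-- the cycle give a reachable configuration i ↦ x^{t_i}_i.  We choose the heights node by node
-- so that y_i = x^{t_i}_i, each time the least height whose defect count has the right value;
-- the running balance of defects of x minus defects of y keeps these counts positive, and
-- since u(y) ≤ u(x) the constraint t_0 ≤ t_{n-1} + 1 closing the cycle holds as well.
-- u(x) ≥ 1 makes the defect counts unbounded, so the starting height at node 0 exists.

module Submission where

open import Data.Bool using (Bool; true; false; not; _∧_; _xor_)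
open import Data.Bool.Properties
  using (xor-assoc; xor-identityʳ; xor-same; not-involutive; not-distribˡ-xor)
  renaming (_≟_ to _≟B_)
open import Data.Bool.Solver using (module xor-∧-Solver)
open import Data.Empty using (⊥-elim)
open import Data.Fin using (Fin; zero; suc; toℕ; fromℕ; inject₁)
open import Data.Fin.Induction using (<-weakInduction)
open import Data.Fin.Properties using (toℕ-inject₁; toℕ-fromℕ)
open import Data.Nat using (ℕ; zero; suc; _+_; _*_; _∸_; _⊓_; _≤_; _<_; _>_; z≤n; s≤s; _≤?_; _<?_)
open import Data.Nat.Properties
open import Data.Nat.Solver using (module +-*-Solver)
open import Data.Product using (Σ; _×_; _,_; proj₁; proj₂)
open import Data.Sum using (_⊎_; inj₁; inj₂; [_,_]′)
open import Data.Vec.Functional using (Vector)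
open import Function using (_∘_)
open import Relation.Binary.Construct.Closure.ReflexiveTransitive using (ε; _◅_; _◅◅_)
open import Relation.Binary.PropositionalEquality
open import Relation.Nullary using (¬_; yes; no)
open import Relation.Nullary.Decidable using (⌊_⌋)
open import Algebra.Properties.CommutativeMonoid.Sum +-0-commutativeMonoid
  using (sum; sum-cong-≗; sum-init-last; ∑-distrib-+)

open import Defs

bit : Bool → ℕ
bit true  = 1
bit false = 0

bit≤1 : ∀ b → bit b ≤ 1
bit≤1 true  = ≤-refl
bit≤1 false = z≤n

bit-xor≤ : ∀ a b → bit (a xor b) ≤ bit a + bit b
bit-xor≤ true  true  = z≤n
bit-xor≤ true  false = ≤-refl
bit-xor≤ false b     = ≤-refl

bit-split : ∀ p d → bit (not p ∧ d) + bit (p ∧ d) ≡ bit d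
bit-split true  d = refl
bit-split false d = +-identityʳ (bit d)

odd : ℕ → Bool
odd zero    = false
odd (suc n) = not (odd n)

odd-+ : ∀ m n → odd (m + n) ≡ odd m xor odd n
odd-+ zero    n = refl
odd-+ (suc m) n = trans (cong not (odd-+ m n)) (not-distribˡ-xor (odd m) (odd n))

odd-bit : ∀ b → odd (bit b) ≡ b
odd-bit true  = refl
odd-bit false = refl

odd-bit-+ : ∀ n b → odd (n + bit b) ≡ odd n xor b
odd-bit-+ n b = trans (odd-+ n (bit b)) (cong (odd n xor_) (odd-bit b))

odd-double : ∀ n → odd (n + n) ≡ false
odd-double n = trans (odd-+ n n) (xor-same (odd n))

xor-cancelˡ : ∀ a b → a xor (a xor b) ≡ b
xor-cancelˡ true  b = not-involutive b
xor-cancelˡ false b = refl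

xor-cancelʳ : ∀ a b → (a xor b) xor b ≡ a
xor-cancelʳ a b = trans (xor-assoc a b b) (trans (cong (a xor_) (xor-same b)) (xor-identityʳ a))

mismatch≡xor : ∀ a b → not ⌊ a ≟B b ⌋ ≡ a xor b
mismatch≡xor true  true  = refl
mismatch≡xor true  false = refl
mismatch≡xor false true  = refl
mismatch≡xor false false = refl

not-∧≡xor-∧ : ∀ p d → not p ∧ d ≡ d xor (p ∧ d)
not-∧≡xor-∧ true  d = sym (xor-same d)
not-∧≡xor-∧ false d = sym (xor-identityʳ d)

apply-xor : ∀ g a b → apply g (a xor b) ≡ apply g a xor b
apply-xor idf  a b = refl
apply-xor negf a b = not-distribˡ-xor a b

record FirstHit (g : ℕ → ℕ) (v K : ℕ) : Set where
  field
    time   : ℕ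
    time≤  : time ≤ K
    hits   : g time ≡ v
    before : ∀ {k} → k < time → g k < v

open FirstHit

lowest : ∀ (g : ℕ → ℕ) v n →
         (Σ ℕ λ k → k < n × v ≤ g k × (∀ {k′} → k′ < k → g k′ < v)) ⊎ (∀ {k} → k < n → g k < v)
lowest g v zero = inj₂ λ ()
lowest g v (suc n) with lowest g v n
... | inj₁ (k , k<n , v≤gk , below) = inj₁ (k , m<n⇒m<1+n k<n , v≤gk , below)
... | inj₂ below with v ≤? g n
...   | yes v≤gn = inj₁ (n , ≤-refl , v≤gn , below)
...   | no  v≰gn = inj₂ λ k<1+n → [ below , (λ { refl → ≰⇒> v≰gn }) ]′ (m<1+n⇒m<n∨m≡n k<1+n)

first-hit : ∀ {g : ℕ → ℕ} → g 0 ≡ 0 → (∀ k → g (suc k) ≤ suc (g k)) →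
            ∀ {v K} → v ≤ g K → FirstHit g v K
first-hit {g} g0≡0 unit-step {v} {K} v≤gK with lowest g v (suc K)
... | inj₂ below = ⊥-elim (<⇒≱ (below ≤-refl) v≤gK)
... | inj₁ (k , k≤K , v≤gk , below) = record
  { time = k ; time≤ = ≤-pred k≤K ; hits = exact k v≤gk below ; before = below }
  where
  exact : ∀ k → v ≤ g k → (∀ {k′} → k′ < k → g k′ < v) → g k ≡ v
  exact zero    v≤g0 _     = trans g0≡0 (sym (n≤0⇒n≡0 (subst (v ≤_) g0≡0 v≤g0)))
  exact (suc k) v≤g  below = ≤-antisym (≤-trans (unit-step k) (below ≤-refl)) v≤g

count≡sum : ∀ {n} (v : Vector Bool n) → count v ≡ sum (bit ∘ v)
count≡sum {zero}  v = refl
count≡sum {suc n} v with v zero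
... | true  = cong suc (count≡sum (v ∘ suc))
... | false = count≡sum (v ∘ suc)

sum-mono-≤ : ∀ {n} {g h : Vector ℕ n} → (∀ i → g i ≤ h i) → sum g ≤ sum h
sum-mono-≤ {zero}  g≤h = z≤n
sum-mono-≤ {suc n} g≤h = +-mono-≤ (g≤h zero) (sum-mono-≤ (g≤h ∘ suc))

term≤sum : ∀ {n} (g : Vector ℕ n) i → g i ≤ sum g
term≤sum g zero    = m≤m+n (g zero) _
term≤sum g (suc i) = ≤-trans (term≤sum (g ∘ suc) i) (m≤n+m _ (g zero))

sum-∘pred : ∀ {m} (g : Vector ℕ (suc m)) → sum (g ∘ pred) ≡ sum g
sum-∘pred {m} g = trans (+-comm (g (fromℕ m)) _) (sym (sum-init-last g))

prefixSum : ∀ {n} → Vector ℕ n → Fin (suc n) → ℕ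
prefixSum g zero    = 0
prefixSum {suc n} g (suc i) = g zero + prefixSum (g ∘ suc) i

prefixSum-suc : ∀ {n} (g : Vector ℕ n) j → prefixSum g (suc j) ≡ prefixSum g (inject₁ j) + g j
prefixSum-suc g zero    = +-comm (g zero) 0
prefixSum-suc g (suc j) =
  trans (cong (g zero +_) (prefixSum-suc (g ∘ suc) j)) (sym (+-assoc (g zero) _ _))

prefixSum-fromℕ : ∀ {n} (g : Vector ℕ n) → prefixSum g (fromℕ n) ≡ sum g
prefixSum-fromℕ {zero}  g = refl
prefixSum-fromℕ {suc n} g = cong (g zero +_) (prefixSum-fromℕ (g ∘ suc))

prefixSum≤sum : ∀ {n} (g : Vector ℕ n) i → prefixSum g i ≤ sum g
prefixSum≤sum g zero    = z≤n
prefixSum≤sum {suc n} g (suc i) = +-monoʳ-≤ (g zero) (prefixSum≤sum (g ∘ suc) i)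

chain : ∀ {n} → (Fin n → ℕ → ℕ) → ℕ → Fin (suc n) → ℕ
chain s a zero    = a
chain {suc n} s a (suc i) = chain (s ∘ suc) (s zero a) i

chain-suc : ∀ {n} (s : Fin n → ℕ → ℕ) a j → chain s a (suc j) ≡ s j (chain s a (inject₁ j))
chain-suc s a zero    = refl
chain-suc s a (suc j) = chain-suc (s ∘ suc) (s zero a) j

module _ {m : ℕ} (f : Circuit (suc m)) where

  u≡sum : ∀ x → u f x ≡ sum (bit ∘ unstable f x)
  u≡sum x = count≡sum (unstable f x)

  unstable≡xor : ∀ x i → unstable f x i ≡ x i xor apply (f i) (x (pred i))
  unstable≡xor x i = mismatch≡xor (x i) _

  apply-pred : ∀ x i → apply (f i) (x (pred i)) ≡ x i xor unstable f x i
  apply-pred x i = sym (trans (cong (x i xor_) (unstable≡xor x i)) (xor-cancelˡ (x i) _))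

  u-cong : ∀ {x y} → (∀ i → x i ≡ y i) → u f x ≡ u f y
  u-cong {x} {y} x≗y = begin
    u f x                     ≡⟨ u≡sum x ⟩
    sum (bit ∘ unstable f x)  ≡⟨ sum-cong-≗ (λ i → cong bit
                                   (cong₂ (λ a b → not ⌊ a ≟B apply (f i) b ⌋) (x≗y i) (x≗y (pred i)))) ⟩
    sum (bit ∘ unstable f y)  ≡⟨ u≡sum y ⟨
    u f y                     ∎
    where open ≡-Reasoning

  update≡xor : ∀ P x i → update f P x i ≡ x i xor (P i ∧ unstable f x i)
  update≡xor P x i with P i
  ... | true  = apply-pred x i
  ... | false = sym (xor-identityʳ (x i))

  unstable-update : ∀ P x i →
    unstable f (update f P x) i ≡ (not (P i) ∧ unstable f x i) xor (P (pred i) ∧ unstable f x (pred i))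
  unstable-update P x i = begin
    unstable f (update f P x) i
      ≡⟨ unstable≡xor (update f P x) i ⟩
    update f P x i xor apply (f i) (update f P x (pred i))
      ≡⟨ cong₂ (λ a b → a xor apply (f i) b) (update≡xor P x i) (update≡xor P x (pred i)) ⟩
    (x i xor fired) xor apply (f i) (x (pred i) xor fired′)
      ≡⟨ cong ((x i xor fired) xor_) (trans (apply-xor (f i) _ fired′) (cong (_xor fired′) (apply-pred x i))) ⟩
    (x i xor fired) xor ((x i xor d) xor fired′)
      ≡⟨ solve 4 (λ a p d q → (a :+ p) :+ ((a :+ d) :+ q) := (d :+ p) :+ q) refl (x i) fired d fired′ ⟩
    (d xor fired) xor fired′
      ≡⟨ cong (_xor fired′) (sym (not-∧≡xor-∧ (P i) d)) ⟩
    (not (P i) ∧ d) xor fired′ ∎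
    where
    open ≡-Reasoning
    open xor-∧-Solver using (solve; _:+_; _:=_)
    d = unstable f x i
    fired = P i ∧ d
    fired′ = P (pred i) ∧ unstable f x (pred i)

  u-update≤ : ∀ P x → u f (update f P x) ≤ u f x
  u-update≤ P x = begin
    u f (update f P x)
      ≡⟨ u≡sum (update f P x) ⟩
    sum (λ i → bit (unstable f (update f P x) i))
      ≡⟨ sum-cong-≗ (λ i → cong bit (unstable-update P x i)) ⟩
    sum (λ i → bit (stay i xor move (pred i)))
      ≤⟨ sum-mono-≤ (λ i → bit-xor≤ (stay i) (move (pred i))) ⟩
    sum (λ i → bit (stay i) + bit (move (pred i)))
      ≡⟨ ∑-distrib-+ (bit ∘ stay) (bit ∘ move ∘ pred) ⟩
    sum (bit ∘ stay) + sum (bit ∘ move ∘ pred)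
      ≡⟨ cong (sum (bit ∘ stay) +_) (sum-∘pred (bit ∘ move)) ⟩
    sum (bit ∘ stay) + sum (bit ∘ move)
      ≡⟨ ∑-distrib-+ (bit ∘ stay) (bit ∘ move) ⟨
    sum (λ i → bit (stay i) + bit (move i))
      ≡⟨ sum-cong-≗ (λ i → bit-split (P i) (unstable f x i)) ⟩
    sum (bit ∘ unstable f x)
      ≡⟨ u≡sum x ⟨
    u f x ∎
    where
    open ≤-Reasoning
    stay move : Fin (suc m) → Bool
    stay i = not (P i) ∧ unstable f x i
    move i = P i ∧ unstable f x i

  u-step≤ : ∀ {x y} → Step f x y → u f y ≤ u f x
  u-step≤ {x} (P , y≗) = ≤-trans (≤-reflexive (u-cong y≗)) (u-update≤ P x)

  u-reach≤ : ∀ {x y} → Reach f x y → u f y ≤ u f x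
  u-reach≤ ε          = ≤-refl
  u-reach≤ (s ◅ x→*y) = ≤-trans (u-reach≤ x→*y) (u-step≤ s)

  parallel : ℕ → Config (suc m) → Config (suc m)
  parallel zero    x   = x
  parallel (suc k) x i = apply (f i) (parallel k x (pred i))

  module _ (x : Config (suc m)) (t : Fin (suc m) → ℕ) (t-step : ∀ i → t i ≤ suc (t (pred i))) where

    -- Round L updates exactly the nodes of height > L; by t-step their predecessors are
    -- then already at height ≥ L.
    staggered : ℕ → Config (suc m)
    staggered L i = parallel (L ⊓ t i) x i

    staggered-step : ∀ L → Step f (staggered L) (staggered (suc L))
    staggered-step L = (λ j → ⌊ L <? t j ⌋) , advance
      where
      advance : ∀ i → staggered (suc L) i ≡ update f (λ j → ⌊ L <? t j ⌋) (staggered L) i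
      advance i with L <? t i
      ... | yes L<ti = trans (cong (λ k → parallel k x i) (m≤n⇒m⊓n≡m L<ti))
        (cong (λ k → apply (f i) (parallel k x (pred i))) (sym (m≤n⇒m⊓n≡m (≤-pred (≤-trans L<ti (t-step i))))))
      ... | no  L≮ti = cong (λ k → parallel k x i)
        (trans (m≥n⇒m⊓n≡n (m≤n⇒m≤1+n (≮⇒≥ L≮ti))) (sym (m≥n⇒m⊓n≡n (≮⇒≥ L≮ti))))

    reach-staggered : ∀ L → Reach f x (staggered L)
    reach-staggered zero    = ε
    reach-staggered (suc L) = reach-staggered L ◅◅ (staggered-step L ◅ ε)

    reach-heights : ∀ y → (∀ i → y i ≡ parallel (t i) x i) → Reach f x y
    reach-heights y y≗ = reach-staggered (sum t) ◅◅ (idle ◅ ε)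
      where
      idle : Step f (staggered (sum t)) y
      idle = (λ _ → false) ,
        λ i → trans (y≗ i) (cong (λ k → parallel k x i) (sym (m≥n⇒m⊓n≡n (term≤sum t i))))

  defects : Config (suc m) → Fin (suc m) → ℕ → ℕ
  defects x i zero    = 0
  defects x i (suc k) = bit (unstable f x i) + defects x (pred i) k

  parallel-parity : ∀ x k i → parallel k x i ≡ x i xor odd (defects x i k)
  parallel-parity x zero    i = sym (xor-identityʳ (x i))
  parallel-parity x (suc k) i = begin
    apply (f i) (parallel k x (pred i))  ≡⟨ cong (apply (f i)) (parallel-parity x k (pred i)) ⟩
    apply (f i) (x (pred i) xor odd d)   ≡⟨ apply-xor (f i) (x (pred i)) (odd d) ⟩
    apply (f i) (x (pred i)) xor odd d   ≡⟨ cong (_xor odd d) (apply-pred x i) ⟩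
    (x i xor U) xor odd d                ≡⟨ xor-assoc (x i) U (odd d) ⟩
    x i xor (U xor odd d)                ≡⟨ cong (x i xor_) (sym (trans (odd-+ (bit U) d) (cong (_xor odd d) (odd-bit U)))) ⟩
    x i xor odd (bit U + d)              ∎
    where
    open ≡-Reasoning
    U = unstable f x i
    d = defects x (pred i) k

  defects-suc≤ : ∀ x i k → defects x i (suc k) ≤ suc (defects x i k)
  defects-suc≤ x i zero    = ≤-trans (≤-reflexive (+-identityʳ _)) (bit≤1 _)
  defects-suc≤ x i (suc k) = ≤-trans (+-monoʳ-≤ (bit (unstable f x i)) (defects-suc≤ x (pred i) k))
                                     (≤-reflexive (+-suc _ _))

  parity-transfer : ∀ x y i k k′ → y (pred i) ≡ parallel k x (pred i) →
                    defects x i k′ + bit (unstable f y i) ≡ defects x i (suc k) →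
                    y i ≡ parallel k′ x i
  parity-transfer x y i k k′ y≡ balance = begin
    y i                                     ≡⟨ xor-cancelʳ (y i) U ⟨
    (y i xor U) xor U                       ≡⟨ cong (_xor U) (apply-pred y i) ⟨
    apply (f i) (y (pred i)) xor U          ≡⟨ cong (λ b → apply (f i) b xor U) y≡ ⟩
    parallel (suc k) x i xor U              ≡⟨ cong (_xor U) (parallel-parity x (suc k) i) ⟩
    (x i xor odd (defects x i (suc k))) xor U ≡⟨ cong (λ n → (x i xor odd n) xor U) balance ⟨
    (x i xor odd (d + bit U)) xor U         ≡⟨ cong (λ b → (x i xor b) xor U) (odd-bit-+ d U) ⟩
    (x i xor (odd d xor U)) xor U           ≡⟨ cong (_xor U) (xor-assoc (x i) (odd d) U) ⟨
    ((x i xor odd d) xor U) xor U           ≡⟨ xor-cancelʳ (x i xor odd d) U ⟩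
    x i xor odd d                           ≡⟨ parallel-parity x k′ i ⟨
    parallel k′ x i                         ∎
    where
    open ≡-Reasoning
    U = unstable f y i
    d = defects x i k′

  defects-prefix : ∀ x i k →
    defects x i (suc (toℕ i) + k) ≡ bit (unstable f x zero) + prefixSum (bit ∘ unstable f x ∘ suc) i + defects x (fromℕ m) k
  defects-prefix x = <-weakInduction P base next
    where
    X : Fin (suc m) → ℕ
    X = bit ∘ unstable f x
    P : Fin (suc m) → Set
    P i = ∀ k → defects x i (suc (toℕ i) + k) ≡ X zero + prefixSum (X ∘ suc) i + defects x (fromℕ m) k
    base : P zero
    base k = cong (_+ defects x (fromℕ m) k) (sym (+-identityʳ (X zero)))
    next : ∀ j → P (inject₁ j) → P (suc j)
    next j IH k = begin
      X (suc j) + defects x (inject₁ j) (suc (toℕ j) + k)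
        ≡⟨ cong (λ n → X (suc j) + defects x (inject₁ j) (suc n + k)) (sym (toℕ-inject₁ j)) ⟩
      X (suc j) + defects x (inject₁ j) (suc (toℕ (inject₁ j)) + k)
        ≡⟨ cong (X (suc j) +_) (IH k) ⟩
      X (suc j) + (X zero + prefixSum (X ∘ suc) (inject₁ j) + dₘ)
        ≡⟨ solve 4 (λ a b c e → a :+ (b :+ c :+ e) := b :+ (c :+ a) :+ e) refl
                   (X (suc j)) (X zero) (prefixSum (X ∘ suc) (inject₁ j)) dₘ ⟩
      X zero + (prefixSum (X ∘ suc) (inject₁ j) + X (suc j)) + dₘ
        ≡⟨ cong (λ n → X zero + n + dₘ) (prefixSum-suc (X ∘ suc) j) ⟨
      X zero + prefixSum (X ∘ suc) (suc j) + dₘ ∎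
      where
      open ≡-Reasoning
      open +-*-Solver using (solve; _:+_; _:=_)
      dₘ = defects x (fromℕ m) k

  defects-period : ∀ x k → defects x (fromℕ m) (suc m + k) ≡ u f x + defects x (fromℕ m) k
  defects-period x k = begin
    defects x (fromℕ m) (suc m + k)
      ≡⟨ cong (λ n → defects x (fromℕ m) (suc n + k)) (sym (toℕ-fromℕ m)) ⟩
    defects x (fromℕ m) (suc (toℕ (fromℕ m)) + k)
      ≡⟨ defects-prefix x (fromℕ m) k ⟩
    bit (unstable f x zero) + prefixSum (bit ∘ unstable f x ∘ suc) (fromℕ m) + defects x (fromℕ m) k
      ≡⟨ cong (λ n → bit (unstable f x zero) + n + defects x (fromℕ m) k) (prefixSum-fromℕ (bit ∘ unstable f x ∘ suc)) ⟩
    sum (bit ∘ unstable f x) + defects x (fromℕ m) k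
      ≡⟨ cong (_+ defects x (fromℕ m) k) (u≡sum x) ⟨
    u f x + defects x (fromℕ m) k ∎
    where open ≡-Reasoning

  defects-unbounded : ∀ x → 1 ≤ u f x → ∀ b → b ≤ defects x zero (suc (b * suc m))
  defects-unbounded x 0<u b = ≤-trans (laps b) (m≤n+m _ (bit (unstable f x zero)))
    where
    laps : ∀ k → k ≤ defects x (fromℕ m) (k * suc m)
    laps zero    = z≤n
    laps (suc k) = ≤-trans (+-mono-≤ 0<u (laps k)) (≤-reflexive (sym (defects-period x (k * suc m))))

m+n≡o+p∧n<o⇒0<m : ∀ {m n o p} → m + n ≡ o + p → n < o → 0 < m
m+n≡o+p∧n<o⇒0<m {zero}  eq n<o = ⊥-elim (<⇒≱ n<o (≤-trans (m≤m+n _ _) (≤-reflexive (sym eq))))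
m+n≡o+p∧n<o⇒0<m {suc m} _  _   = s≤s z≤n

module HeightProfile {m : ℕ} (f : Circuit (suc m)) (x y : Config (suc m))
                     (0<ux : 1 ≤ u f x) (uy≤ux : u f y ≤ u f x) where

  X Y : Fin (suc m) → ℕ
  X = bit ∘ unstable f x
  Y = bit ∘ unstable f y

  c : Fin (suc m) → ℕ → ℕ
  c = defects f x

  -- B has the parity x₀ xor y₀ and exceeds u(y), which keeps the running balance c i k of
  -- Fits positive, so the truncated subtraction in nextHit is exact.
  B : ℕ
  B = bit (x zero xor y zero) + (suc (u f y) + suc (u f y))

  Fits : Fin (suc m) → ℕ → Set
  Fits i k = c i k + prefixSum (Y ∘ suc) i ≡ B + prefixSum (X ∘ suc) i × y i ≡ parallel f k x i

  start : FirstHit (c zero) B (suc (B * suc m))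
  start = first-hit refl (defects-suc≤ f x zero) (defects-unbounded f x 0<ux B)

  nextHit : ∀ j k → FirstHit (c (suc j)) (c (suc j) (suc k) ∸ Y (suc j)) (suc k)
  nextHit j k = first-hit refl (defects-suc≤ f x (suc j)) (m∸n≤m (c (suc j) (suc k)) (Y (suc j)))

  height : Fin (suc m) → ℕ
  height = chain (λ j k → time (nextHit j k)) (time start)

  height-suc : ∀ j → height (suc j) ≡ time (nextHit j (height (inject₁ j)))
  height-suc = chain-suc (λ j k → time (nextHit j k)) (time start)

  prefixY≤uy : ∀ i → prefixSum (Y ∘ suc) i ≤ u f y
  prefixY≤uy i = begin
    prefixSum (Y ∘ suc) i  ≤⟨ prefixSum≤sum (Y ∘ suc) i ⟩
    sum (Y ∘ suc)          ≤⟨ m≤n+m _ (Y zero) ⟩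
    sum Y                  ≡⟨ u≡sum f y ⟨
    u f y                  ∎
    where open ≤-Reasoning

  prefixY<B : ∀ i → prefixSum (Y ∘ suc) i < B
  prefixY<B i = ≤-trans (s≤s (prefixY≤uy i)) (≤-trans (m≤m+n (suc (u f y)) _) (m≤n+m _ (bit (x zero xor y zero))))

  Fits-zero : Fits zero (time start)
  Fits-zero = cong (_+ 0) (hits start) , (begin
    y zero                              ≡⟨ xor-cancelˡ (x zero) (y zero) ⟨
    x zero xor (x zero xor y zero)      ≡⟨ cong (x zero xor_) odd-B ⟨
    x zero xor odd B                    ≡⟨ cong (λ n → x zero xor odd n) (hits start) ⟨
    x zero xor odd (c zero (time start)) ≡⟨ parallel-parity f x (time start) zero ⟨
    parallel f (time start) x zero      ∎)
    where
    open ≡-Reasoning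
    N = suc (u f y)
    odd-B : odd B ≡ x zero xor y zero
    odd-B = trans (odd-+ (bit (x zero xor y zero)) (N + N))
      (trans (cong₂ _xor_ (odd-bit (x zero xor y zero)) (odd-double N)) (xor-identityʳ _))

  Fits-next : ∀ j k → Fits (inject₁ j) k → Fits (suc j) (time (nextHit j k))
  Fits-next j k (balance , y≡) = balance′ , parity-transfer f x y i k k′ y≡ (trans (cong (_+ Y i) (hits hit)) v+Y)
    where
    i = suc j
    hit = nextHit j k
    k′ = time hit
    v = c i (suc k) ∸ Y i
    v+Y : v + Y i ≡ c i (suc k)
    v+Y = m∸n+n≡m (≤-trans (bit≤1 (unstable f y i)) (≤-trans (m+n≡o+p∧n<o⇒0<m balance (prefixY<B (inject₁ j))) (m≤n+m _ (X i))))
    balance′ : c i k′ + prefixSum (Y ∘ suc) i ≡ B + prefixSum (X ∘ suc) i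
    balance′ = begin
      c i k′ + prefixSum (Y ∘ suc) i
        ≡⟨ cong₂ _+_ (hits hit) (prefixSum-suc (Y ∘ suc) j) ⟩
      v + (ΣY + Y i)
        ≡⟨ solve 3 (λ a b e → a :+ (b :+ e) := (a :+ e) :+ b) refl v ΣY (Y i) ⟩
      (v + Y i) + ΣY
        ≡⟨ cong (_+ ΣY) v+Y ⟩
      X i + c (inject₁ j) k + ΣY
        ≡⟨ +-assoc (X i) _ ΣY ⟩
      X i + (c (inject₁ j) k + ΣY)
        ≡⟨ cong (X i +_) balance ⟩
      X i + (B + ΣX)
        ≡⟨ solve 3 (λ a b e → a :+ (b :+ e) := b :+ (e :+ a)) refl (X i) B ΣX ⟩
      B + (ΣX + X i)
        ≡⟨ cong (B +_) (prefixSum-suc (X ∘ suc) j) ⟨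
      B + prefixSum (X ∘ suc) i ∎
      where
      open ≡-Reasoning
      open +-*-Solver using (solve; _:+_; _:=_)
      ΣX = prefixSum (X ∘ suc) (inject₁ j)
      ΣY = prefixSum (Y ∘ suc) (inject₁ j)

  fits : ∀ i → Fits i (height i)
  fits = <-weakInduction (λ i → Fits i (height i)) Fits-zero
    (λ j fits-j → subst (Fits (suc j)) (sym (height-suc j)) (Fits-next j (height (inject₁ j)) fits-j))

  wraps : B ≤ c zero (suc (height (fromℕ m)))
  wraps = +-cancelʳ-≤ ΣY B (X zero + c (fromℕ m) (height (fromℕ m))) (begin
    B + ΣY                  ≤⟨ +-monoʳ-≤ B (≤-trans (prefixY≤uy (fromℕ m)) uy≤ux) ⟩
    B + u f x               ≡⟨ cong (B +_) (u≡sum f x) ⟩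
    B + (X zero + sum (X ∘ suc)) ≡⟨ cong (λ n → B + (X zero + n)) (prefixSum-fromℕ (X ∘ suc)) ⟨
    B + (X zero + ΣX)       ≡⟨ solve 3 (λ b a e → b :+ (a :+ e) := a :+ (b :+ e)) refl B (X zero) ΣX ⟩
    X zero + (B + ΣX)       ≡⟨ cong (X zero +_) (proj₁ (fits (fromℕ m))) ⟨
    X zero + (c (fromℕ m) (height (fromℕ m)) + ΣY) ≡⟨ +-assoc (X zero) _ ΣY ⟨
    X zero + c (fromℕ m) (height (fromℕ m)) + ΣY ∎)
    where
    open ≤-Reasoning
    open +-*-Solver using (solve; _:+_; _:=_)
    ΣX = prefixSum (X ∘ suc) (fromℕ m)
    ΣY = prefixSum (Y ∘ suc) (fromℕ m)

  height-step : ∀ i → height i ≤ suc (height (pred i))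
  height-step zero    = ≮⇒≥ λ late → <⇒≱ (before start late) wraps
  height-step (suc j) = ≤-trans (≤-reflexive (height-suc j)) (time≤ (nextHit j _))

  reach : Reach f x y
  reach = reach-heights f x height height-step y (proj₂ ∘ fits)

u≤⇒Reach : ∀ {m} (f : Circuit (suc m)) {x y} → 1 ≤ u f x → u f y ≤ u f x → Reach f x y
u≤⇒Reach f {x} {y} = HeightProfile.reach f x y

lemma5 : ∀ (m : ℕ) (f : Circuit (ℕ.suc m)) (x y : Config (ℕ.suc m)) →
    u f x > u f y → Reach f x y × ¬ Reach f y x
lemma5 m f x y uy<ux =
  u≤⇒Reach f (≤-trans (s≤s z≤n) uy<ux) (<⇒≤ uy<ux) , λ y→*x → <⇒≱ uy<ux (u-reach≤ f y→*x)
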